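{- Let $A$ be a finite nonempty alphabet, let $S\subset A^*$ be an acyclic set, let $X\subset S$ be a finite bifix code and let $f:B^*\to A^*$ be a coding morphism for $X$. If the bifix decoding $f^{ -1}(S)\subset B^*$ is biextendable, then $f^{ -1}(S)$ is acyclic.
   Context: A set $T$ of words is factorial if it contains all factors of its elements. For $w\in T$: $L(w)$, $R(w)$ are the sets of letters $a$ with $aw\in T$, resp. $wa\in T$, and $E(w)=\{(a,b)\mid awb\in T\}$; $T$ is biextendable if factorial and $E(w)\ne\emptyset$ for all $w\in T$. The extension graph of $w$ is the undirected bipartite graph with vertex set the disjoint union of $L(w)$ and $R(w)$ and an edge $a$–$b$ for each $(a,b)\in E(w)$; $T$ is acyclic if biextendable and all extension graphs are acyclic. A bifix code is a set of nonempty words containing no proper prefix and no proper suffix of its elements. A coding morphism for $X$ is a monoid morphism $f:B^*\to A^*$ ($B$ an alphabet) mapping $B$ bijectively onto $X$; $f^{ -1}(S)$ is called a bifix decoding of $S$. -}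

module Defs where

open import Data.Nat using (ℕ; zero; suc; _<_; _≤_)
open import Data.Fin using (Fin)
open import Data.List using (List; []; _∷_; _++_; [_]; concatMap)
open import Data.Product using (_×_; Σ; ∃; ∃-syntax; _,_)
open import Function.Bundles using (_⇔_)
open import Relation.Binary.PropositionalEquality using (_≡_; _≢_)

Lang : Set → Set₁
Lang A = List A → Set

module _ {A : Set} where

  Factorial : Lang A → Set
  Factorial T = ∀ u w v → T (u ++ w ++ v) → T w

  E : Lang A → List A → A → A → Set
  E T w a b = T (a ∷ w ++ [ b ])

  Biextendable : Lang A → Set
  Biextendable T = Factorial T × (∀ w → T w → ∃[ a ] ∃[ b ] E T w a b)

  -- A cycle in the (undirected, bipartite) extension graph of w, whose vertex
  -- set is the disjoint union of L(w) and R(w) and with an edge a–b for each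
  -- (a,b) ∈ E(w).  Since the graph is bipartite, a cycle has even length 2k
  -- with k ≥ 2 and is of the form a₀ – b₀ – a₁ – b₁ – … – a_{k-1} – b_{k-1} – a₀
  -- with a₀,…,a_{k-1} ∈ L(w) pairwise distinct and b₀,…,b_{k-1} ∈ R(w)
  -- pairwise distinct.  We index by ℕ and set aₖ = a₀.
  record ExtCycle (T : Lang A) (w : List A) : Set where
    field
      k      : ℕ
      k≥2    : 2 ≤ k
      a b    : ℕ → A
      close  : a k ≡ a 0
      edge₁  : ∀ i → i < k → E T w (a i) (b i)
      edge₂  : ∀ i → i < k → E T w (a (suc i)) (b i)
      a-inj  : ∀ i j → i < k → j < k → a i ≡ a j → i ≡ j
      b-inj  : ∀ i j → i < k → j < k → b i ≡ b j → i ≡ j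

  ExtAcyclic : Lang A → List A → Set
  ExtAcyclic T w = ExtCycle T w → Data.Empty.⊥
    where import Data.Empty

  Acyclic : Lang A → Set
  Acyclic T = Biextendable T × (∀ w → T w → ExtAcyclic T w)

  BifixCode : Lang A → Set
  BifixCode X =
      (∀ x → X x → x ≢ [])
    × (∀ x y u → X x → X y → x ≡ y ++ u → u ≡ [])
    × (∀ x y u → X x → X y → x ≡ u ++ y → u ≡ [])

morph : {A B : Set} → (B → List A) → List B → List A
morph f = concatMap f

CodingMorphism : {A B : Set} → Lang A → (B → List A) → Set
CodingMorphism X f =
    (∀ b c → f b ≡ f c → b ≡ c)
  × (∀ x → X x ⇔ (∃[ b ] f b ≡ x))

decoding : {A B : Set} → (B → List A) → Lang A → Lang B
decoding f S w = S (morph f w)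

-- A finite bipartite graph without cycles has fewer edges than vertices (delete
-- vertices of degree ≤ 1; once none is left, a non-backtracking walk closes a
-- cycle).  Call a bipartite graph whose left vertices form a suffix code, whose
-- right vertices form a prefix code, and whose edges u – v satisfy u w v ∈ S a
-- generalised extension graph of w.  If S is acyclic, each of these has fewer
-- edges than vertices, by induction on the total length of the vertices: if some
-- right vertex beginning with a letter d is longer than d, merge all right
-- vertices beginning with d into the single vertex d; the merged part, with d
-- moved into the context, is a generalised extension graph of w d, and the two
-- bounds add up.  Long left vertices are handled in the same way after reversing
-- all words, and graphs on letters are subgraphs of extension graphs of S.
-- Finally, f maps a cycle of length 2k in the extension graph of w in f⁻¹(S) to
-- 2k edges between 2k words of the bifix code X forming a generalised extension
-- graph of f(w), which is impossible.

module Submission where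

open import Defs
open import Data.Fin using (Fin)
import Data.Fin as Fin
open import Data.Nat using (ℕ; zero; suc; _+_; _≤_; _<_; _≤?_; _<?_; z≤n; s≤s; z<s)
open import Data.Nat.Properties
open import Data.Nat.ListAction using (sum)
open import Data.Nat.Tactic.RingSolver using (solve-∀)
open import Data.List using (List; []; _∷_; _++_; [_]; map; length; filter; applyDownFrom; reverse; drop)
open import Data.List.Properties
  using (filter-notAll; filter-some; length-applyDownFrom; length-map; length-++; ++-assoc; ++-identityʳ; concatMap-++;
         reverse-++; reverse-involutive; reverse-injective; length-reverse; ∷-injectiveˡ; ∷-injectiveʳ; ≡-dec)
open import Data.List.Membership.Propositional using (_∈_; _∉_; find; lose)
open import Data.List.Membership.Propositional.Properties
  using (∈-map⁺; ∈-map⁻; ∈-++⁻; ∈-filter⁺; ∈-filter⁻; ∈-applyDownFrom⁺; ∈-applyDownFrom⁻; ∈-length)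
import Data.List.Membership.DecPropositional as DecMembership
import Data.List.Relation.Unary.All as All
open import Data.List.Relation.Unary.Any as Any using (Any; here; there; any?)
open import Data.List.Relation.Unary.Unique.Propositional using (Unique; []; _∷_)
import Data.List.Relation.Unary.Unique.Propositional.Properties as Unique
open import Data.List.Relation.Binary.Subset.Propositional using (_⊆_)
open import Data.Empty using (⊥-elim)
open import Data.Product using (∃-syntax; _×_; _,_; proj₁; proj₂; map₂)
import Data.Product.Properties as Product
open import Data.Sum using (inj₁; inj₂)
open import Function using (_∘_; id; case_of_)
open import Function.Bundles using (Equivalence)
open import Relation.Nullary using (¬_; yes; no; ¬?)
open import Relation.Unary using (Pred; Decidable; ∁)
open import Relation.Unary.Properties using (∁?)
open import Relation.Binary.Definitions using (DecidableEquality)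
open import Relation.Binary.PropositionalEquality hiding ([_])
open import Algebra.Properties.CommutativeSemigroup +-commutativeSemigroup using (x∙yz≈y∙xz)

module _ {A : Set} where

  unique-⊆⇒length≤ : DecidableEquality A → {xs ys : List A} → Unique xs → xs ⊆ ys → length xs ≤ length ys
  unique-⊆⇒length≤ _≟_ {[]} _ _ = z≤n
  unique-⊆⇒length≤ _≟_ {x ∷ xs} {ys} (x∉xs ∷ xs!) xs⊆ys = begin-strict
    length xs                                ≤⟨ unique-⊆⇒length≤ _≟_ xs! xs⊆ys-x ⟩
    length (filter (λ y → ¬? (y ≟ x)) ys)    <⟨ filter-notAll _ ys x∈ys ⟩
    length ys                                ∎
    where
    open ≤-Reasoning
    xs⊆ys-x : xs ⊆ filter (λ y → ¬? (y ≟ x)) ys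
    xs⊆ys-x z∈xs = ∈-filter⁺ _ (xs⊆ys (there z∈xs)) (λ z≡x → All.lookup x∉xs z∈xs (sym z≡x))
    x∈ys : Any (∁ (λ y → ¬ y ≡ x)) ys
    x∈ys = Any.map (λ x≡y y≢x → y≢x (sym x≡y)) (xs⊆ys (here refl))

  module _ {ℓ} {P : Pred A ℓ} (P? : Decidable P) where

    length-filter-partition : ∀ xs → length (filter P? xs) + length (filter (∁? P?) xs) ≡ length xs
    length-filter-partition [] = refl
    length-filter-partition (x ∷ xs) with P? x
    ... | yes _ = cong suc (length-filter-partition xs)
    ... | no _ = trans (+-suc _ _) (cong suc (length-filter-partition xs))

    sum-filter-partition : (g : A → ℕ) → ∀ xs →
                           sum (map g (filter P? xs)) + sum (map g (filter (∁? P?) xs)) ≡ sum (map g xs)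
    sum-filter-partition g [] = refl
    sum-filter-partition g (x ∷ xs) with P? x
    ... | yes _ = trans (+-assoc (g x) _ _) (cong (g x +_) (sum-filter-partition g xs))
    ... | no _ = trans (x∙yz≈y∙xz (sum (map g (filter P? xs))) (g x) _) (cong (g x +_) (sum-filter-partition g xs))

    sum-filter≤ : (g : A → ℕ) → ∀ xs → sum (map g (filter P? xs)) ≤ sum (map g xs)
    sum-filter≤ g xs = subst (sum (map g (filter P? xs)) ≤_) (sum-filter-partition g xs) (m≤m+n _ _)

  another-element : DecidableEquality A → {xs : List A} → Unique xs → 2 ≤ length xs →
                    ∀ z → ∃[ z′ ] z′ ∈ xs × z′ ≢ z
  another-element _≟_ {_ ∷ []} _ (s≤s ())
  another-element _≟_ {x ∷ y ∷ _} ((x≢y All.∷ _) ∷ _) _ z with x ≟ z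
  ... | yes refl = y , there (here refl) , λ y≡x → x≢y (sym y≡x)
  ... | no x≢z = x , here refl , x≢z

  unique⇒count≡1 : (_≟_ : DecidableEquality A) {xs : List A} → Unique xs → ∀ {x} → x ∈ xs →
                 length (filter (_≟ x) xs) ≡ 1
  unique⇒count≡1 _≟_ {xs} xs! {x} x∈xs = ≤-antisym
    (unique-⊆⇒length≤ _≟_ {ys = [ x ]} (Unique.filter⁺ (_≟ x) xs!)
                      (λ z∈ → here (proj₂ (∈-filter⁻ (_≟ x) {xs = xs} z∈))))
    (filter-some (_≟ x) (lose x∈xs refl))

  ∈-of-nonempty : {xs : List A} → 0 < length xs → ∃[ x ] x ∈ xs
  ∈-of-nonempty {x ∷ _} _ = x , here refl

  ∈-applyDownFrom-all : {P : A → Set} {g : ℕ → A} {k : ℕ} → (∀ i → P (g i)) →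
                        ∀ {x} → x ∈ applyDownFrom g k → P x
  ∈-applyDownFrom-all {g = g} Pg x∈ with ∈-applyDownFrom⁻ g x∈
  ... | i , _ , refl = Pg i

  ∈⇒≤sum : (g : A → ℕ) → ∀ {x xs} → x ∈ xs → g x ≤ sum (map g xs)
  ∈⇒≤sum g (here refl) = m≤m+n _ _
  ∈⇒≤sum g {xs = y ∷ _} (there x∈) = ≤-trans (∈⇒≤sum g x∈) (m≤n+m _ (g y))

module _ {B C : Set} {f : C → B} {g : B → C} {xs : List B} (retract : ∀ {x} → x ∈ xs → f (g x) ≡ x) where

  map-retract : map f (map g xs) ≡ xs
  map-retract = go xs (λ x∈ → x∈)
    where
    go : ∀ ys → (∀ {x} → x ∈ ys → x ∈ xs) → map f (map g ys) ≡ ys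
    go [] _ = refl
    go (y ∷ ys) ys⊆ = cong₂ _∷_ (retract (ys⊆ (here refl))) (go ys (ys⊆ ∘ there))

  ∈-map-retract⁻ : ∀ {y} → y ∈ map g xs → f y ∈ xs
  ∈-map-retract⁻ y∈ with ∈-map⁻ g y∈
  ... | x , x∈ , refl = subst (_∈ xs) (sym (retract x∈)) x∈

  unique-map-retract : Unique xs → Unique (map g xs)
  unique-map-retract xs! = Unique.map⁻ (subst Unique (sym map-retract) xs!)

InjectiveBelow : {Z : Set} → ℕ → (ℕ → Z) → Set
InjectiveBelow k g = ∀ i j → i < k → j < k → g i ≡ g j → i ≡ j

injectiveBelow-shift : {Z : Set} {g : ℕ → Z} (r : ℕ) {k : ℕ} →
                       InjectiveBelow (r + k) g → InjectiveBelow k (λ i → g (r + i))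
injectiveBelow-shift r inj i j i<k j<k eq = +-cancelˡ-≡ r i j (inj _ _ (+-monoʳ-< r i<k) (+-monoʳ-< r j<k) eq)

injectiveBelow-suc : {Z : Set} (g : ℕ → Z) {t : ℕ} →
                     InjectiveBelow t g → g t ∉ applyDownFrom g t → InjectiveBelow (suc t) g
injectiveBelow-suc g inj fresh i j i<1+t j<1+t gi≡gj with m<1+n⇒m<n∨m≡n i<1+t | m<1+n⇒m<n∨m≡n j<1+t
... | inj₁ i<t | inj₁ j<t = inj i j i<t j<t gi≡gj
... | inj₁ i<t | inj₂ refl = ⊥-elim (fresh (subst (_∈ applyDownFrom g _) gi≡gj (∈-applyDownFrom⁺ g i<t)))
... | inj₂ refl | inj₁ j<t = ⊥-elim (fresh (subst (_∈ applyDownFrom g _) (sym gi≡gj) (∈-applyDownFrom⁺ g j<t)))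
... | inj₂ refl | inj₂ refl = refl

injectiveBelow⇒unique : {Z : Set} (g : ℕ → Z) {t : ℕ} → InjectiveBelow t g → Unique (applyDownFrom g t)
injectiveBelow⇒unique g {t} inj =
  Unique.applyDownFrom⁺₁ g t (λ j<i i<t gi≡gj → <⇒≢ j<i (sym (inj _ _ i<t (<-trans j<i i<t) gi≡gj)))

repeat-gap≥2 : {Z : Set} (g : ℕ → Z) → (∀ i → g (suc i) ≢ g i) →
               ∀ r k → r < r + k → g (r + k) ≡ g r → 2 ≤ k
repeat-gap≥2 g moves r zero r<r _ = ⊥-elim (<-irrefl (sym (+-identityʳ r)) r<r)
repeat-gap≥2 g moves r (suc zero) _ g[r+1]≡g[r] = ⊥-elim (moves r (trans (cong g (+-comm 1 r)) g[r+1]≡g[r]))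
repeat-gap≥2 g moves r (suc (suc k)) _ _ = s≤s (s≤s z≤n)

record Cycle {X Y : Set} (E : X → Y → Set) : Set where
  field
    k     : ℕ
    k≥2   : 2 ≤ k
    a     : ℕ → X
    b     : ℕ → Y
    close : a k ≡ a 0
    edge₁ : ∀ i → i < k → E (a i) (b i)
    edge₂ : ∀ i → i < k → E (a (suc i)) (b i)
    a-inj : InjectiveBelow k a
    b-inj : InjectiveBelow k b

module _ {X Y X′ Y′ : Set} {E : X → Y → Set} {E′ : X′ → Y′ → Set} where

  mapCycle : (g : X → X′) (h : Y → Y′) → (∀ {x y} → E x y → E′ (g x) (h y)) →
             (∀ {x y x′ y′} → E x y → E x′ y′ → g x ≡ g x′ → x ≡ x′) →
             (∀ {x y x′ y′} → E x y → E x′ y′ → h y ≡ h y′ → y ≡ y′) →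
             Cycle E → Cycle E′
  mapCycle g h hom g-inj h-inj c = record
    { k = k ; k≥2 = k≥2 ; a = g ∘ a ; b = h ∘ b ; close = cong g close
    ; edge₁ = λ i i<k → hom (edge₁ i i<k)
    ; edge₂ = λ i i<k → hom (edge₂ i i<k)
    ; a-inj = λ i j i<k j<k eq → a-inj i j i<k j<k (g-inj (edge₁ i i<k) (edge₁ j j<k) eq)
    ; b-inj = λ i j i<k j<k eq → b-inj i j i<k j<k (h-inj (edge₁ i i<k) (edge₁ j j<k) eq)
    }
    where open Cycle c

cycle-weaken : {X Y : Set} {E E′ : X → Y → Set} → (∀ {x y} → E x y → E′ x y) → Cycle E → Cycle E′
cycle-weaken sub = mapCycle id id sub (λ _ _ → id) (λ _ _ → id)

module _ {A : Set} {T : Lang A} {w : List A} where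

  cycle⇒extCycle : Cycle (E T w) → ExtCycle T w
  cycle⇒extCycle c = record
    { k = k ; k≥2 = k≥2 ; a = a ; b = b ; close = close
    ; edge₁ = edge₁ ; edge₂ = edge₂ ; a-inj = a-inj ; b-inj = b-inj }
    where open Cycle c

  extCycle⇒cycle : ExtCycle T w → Cycle (E T w)
  extCycle⇒cycle c = record
    { k = k ; k≥2 = k≥2 ; a = a ; b = b ; close = close
    ; edge₁ = edge₁ ; edge₂ = edge₂ ; a-inj = a-inj ; b-inj = b-inj }
    where open ExtCycle c

record Graph (X Y : Set) : Set where
  field
    left         : List X
    right        : List Y
    edges        : List (X × Y)
    left-unique  : Unique left
    right-unique : Unique right
    edges-unique : Unique edges
    edge-ends    : ∀ {x y} → (x , y) ∈ edges → x ∈ left × y ∈ right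

  Edge : X → Y → Set
  Edge x y = (x , y) ∈ edges

  order : ℕ
  order = length left + length right

  size : ℕ
  size = length edges

open Graph

Sparse : {X Y : Set} → Graph X Y → Set
Sparse G = 0 < order G → size G < order G

leaf-deletion-keeps-dense : ∀ {o o′ s s′ d} → suc o′ ≡ o → d + s′ ≡ s → d ≤ 1 → o ≤ s → o′ ≤ s′
leaf-deletion-keeps-dense refl refl d≤1 o≤s = ≤-pred (≤-trans o≤s (+-monoˡ-≤ _ d≤1))

module Dense {X Y : Set} (_≟X_ : DecidableEquality X) (_≟Y_ : DecidableEquality Y) where

  _≟E_ : DecidableEquality (X × Y)
  _≟E_ = Product.≡-dec _≟X_ _≟Y_

  module _ (G : Graph X Y) where

    degreeˡ : X → ℕ
    degreeˡ x = length (filter ((_≟X x) ∘ proj₁) (edges G))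

    degreeʳ : Y → ℕ
    degreeʳ y = length (filter ((_≟Y y) ∘ proj₂) (edges G))

    deleteˡ : X → Graph X Y
    deleteˡ x = record
      { left = filter (∁? (_≟X x)) (left G)
      ; right = right G
      ; edges = filter (∁? ((_≟X x) ∘ proj₁)) (edges G)
      ; left-unique = Unique.filter⁺ _ (left-unique G)
      ; right-unique = right-unique G
      ; edges-unique = Unique.filter⁺ _ (edges-unique G)
      ; edge-ends = λ e∈ → let e∈G , x′≢x = ∈-filter⁻ _ e∈ ; x′∈ , y∈ = edge-ends G e∈G
                           in ∈-filter⁺ _ x′∈ x′≢x , y∈
      }

    deleteʳ : Y → Graph X Y
    deleteʳ y = record
      { left = left G
      ; right = filter (∁? (_≟Y y)) (right G)
      ; edges = filter (∁? ((_≟Y y) ∘ proj₂)) (edges G)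
      ; left-unique = left-unique G
      ; right-unique = Unique.filter⁺ _ (right-unique G)
      ; edges-unique = Unique.filter⁺ _ (edges-unique G)
      ; edge-ends = λ e∈ → let e∈G , y′≢y = ∈-filter⁻ _ e∈ ; x∈ , y′∈ = edge-ends G e∈G
                           in x∈ , ∈-filter⁺ _ y′∈ y′≢y
      }

    order-deleteˡ : ∀ {x} → x ∈ left G → suc (order (deleteˡ x)) ≡ order G
    order-deleteˡ {x} x∈ = cong (_+ length (right G)) (begin
      suc rest                                      ≡⟨ cong (_+ rest) (unique⇒count≡1 _≟X_ (left-unique G) x∈) ⟨
      length (filter (_≟X x) (left G)) + rest       ≡⟨ length-filter-partition (_≟X x) (left G) ⟩
      length (left G)                               ∎)
      where
      open ≡-Reasoning
      rest : ℕ
      rest = length (filter (∁? (_≟X x)) (left G))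

    order-deleteʳ : ∀ {y} → y ∈ right G → suc (order (deleteʳ y)) ≡ order G
    order-deleteʳ {y} y∈ = begin
      suc (length (left G) + rest)                                ≡⟨ +-suc _ rest ⟨
      length (left G) + suc rest
        ≡⟨ cong (λ c → length (left G) + (c + rest)) (unique⇒count≡1 _≟Y_ (right-unique G) y∈) ⟨
      length (left G) + (length (filter (_≟Y y) (right G)) + rest)
        ≡⟨ cong (length (left G) +_) (length-filter-partition (_≟Y y) (right G)) ⟩
      order G                                                     ∎
      where
      open ≡-Reasoning
      rest : ℕ
      rest = length (filter (∁? (_≟Y y)) (right G))

    size-deleteˡ : ∀ x → degreeˡ x + size (deleteˡ x) ≡ size G
    size-deleteˡ x = length-filter-partition ((_≟X x) ∘ proj₁) (edges G)

    size-deleteʳ : ∀ y → degreeʳ y + size (deleteʳ y) ≡ size G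
    size-deleteʳ y = length-filter-partition ((_≟Y y) ∘ proj₂) (edges G)

    branchingˡ : ∀ {x} → 2 ≤ degreeˡ x → ∀ y → ∃[ y′ ] Edge G x y′ × y′ ≢ y
    branchingˡ {x} 2≤deg y with another-element _≟E_ (Unique.filter⁺ _ (edges-unique G)) 2≤deg (x , y)
    ... | (x′ , y′) , e∈ , e≢ with ∈-filter⁻ ((_≟X x) ∘ proj₁) {xs = edges G} e∈
    ...   | e∈G , refl = y′ , e∈G , λ y′≡y → e≢ (cong (x ,_) y′≡y)

    branchingʳ : ∀ {y} → 2 ≤ degreeʳ y → ∀ x → ∃[ x′ ] Edge G x′ y × x′ ≢ x
    branchingʳ {y} 2≤deg x with another-element _≟E_ (Unique.filter⁺ _ (edges-unique G)) 2≤deg (x , y)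
    ... | (x′ , y′) , e∈ , e≢ with ∈-filter⁻ ((_≟Y y) ∘ proj₂) {xs = edges G} e∈
    ...   | e∈G , refl = x′ , e∈G , λ x′≡x → e≢ (cong (_, y) x′≡x)

  module Walk (G : Graph X Y)
              (branchˡ : ∀ {x} → x ∈ left G → ∀ y → ∃[ y′ ] Edge G x y′ × y′ ≢ y)
              (branchʳ : ∀ {y} → y ∈ right G → ∀ x → ∃[ x′ ] Edge G x′ y × x′ ≢ x)
              {x₀ : X} {y₀ : Y} (e₀ : Edge G x₀ y₀) where

    record Dart : Set where
      constructor dart
      field
        src  : X
        tgt  : Y
        edge : Edge G src tgt
    open Dart

    record Continuation (d : Dart) : Set where
      field
        next      : Dart
        back-edge : Edge G (src next) (tgt d)
        src-moves : src next ≢ src d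
        tgt-moves : tgt next ≢ tgt d
    open Continuation

    continue : (d : Dart) → Continuation d
    continue (dart x y e) =
      let x′ , e′ , x′≢x = branchʳ (proj₂ (edge-ends G e)) x
          y′ , e″ , y′≢y = branchˡ (proj₁ (edge-ends G e′)) y
      in record { next = dart x′ y′ e″ ; back-edge = e′ ; src-moves = x′≢x ; tgt-moves = y′≢y }

    walk : ℕ → Dart
    walk zero = dart x₀ y₀ e₀
    walk (suc i) = next (continue (walk i))

    u : ℕ → X
    u i = src (walk i)

    v : ℕ → Y
    v i = tgt (walk i)

    back : ∀ r i → Edge G (u (r + suc i)) (v (r + i))
    back r i rewrite +-suc r i = back-edge (continue (walk (r + i)))

    cycleAt : ∀ r k (a : ℕ → X) → 2 ≤ k → a k ≡ a 0 → (∀ i → a (suc i) ≡ u (r + suc i)) →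
              Edge G (a 0) (v r) → InjectiveBelow k a → InjectiveBelow k (λ i → v (r + i)) → Cycle (Edge G)
    cycleAt r k a k≥2 close a-walk first a-inj b-inj = record
      { k = k ; k≥2 = k≥2 ; a = a ; b = λ i → v (r + i) ; close = close
      ; edge₁ = edge₁
      ; edge₂ = λ i _ → subst (λ x → Edge G x (v (r + i))) (sym (a-walk i)) (back r i)
      ; a-inj = a-inj ; b-inj = b-inj
      }
      where
      edge₁ : ∀ i → i < k → Edge G (a i) (v (r + i))
      edge₁ zero _ = subst (Edge G (a 0) ∘ v) (sym (+-identityʳ r)) first
      edge₁ (suc i) _ = subst (λ x → Edge G x (v (r + suc i))) (sym (a-walk i)) (edge (walk (r + suc i)))

    edge-at : ∀ i → Edge G (u i) (v i)
    edge-at i = edge (walk i)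

    rotate : ℕ → ℕ → ℕ → X
    rotate r k zero = u (r + k)
    rotate r k (suc i) = u (r + suc i)

    rotate-injective : ∀ r k → InjectiveBelow (suc (r + k)) u → InjectiveBelow k (rotate r k)
    rotate-injective r k inj zero zero _ _ _ = refl
    rotate-injective r k inj zero (suc j) _ j<k eq =
      ⊥-elim (<-irrefl (+-cancelˡ-≡ r _ _ (inj _ _ (s≤s (+-monoʳ-≤ r (<⇒≤ j<k))) ≤-refl (sym eq))) j<k)
    rotate-injective r k inj (suc i) zero i<k _ eq =
      ⊥-elim (<-irrefl (+-cancelˡ-≡ r _ _ (inj _ _ (s≤s (+-monoʳ-≤ r (<⇒≤ i<k))) ≤-refl eq)) i<k)
    rotate-injective r k inj (suc i) (suc j) i<k j<k eq =
      +-cancelˡ-≡ r _ _ (inj _ _ (s≤s (+-monoʳ-≤ r (<⇒≤ i<k))) (s≤s (+-monoʳ-≤ r (<⇒≤ j<k))) eq)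

    rotate-close : ∀ r k → 0 < k → rotate r k k ≡ rotate r k 0
    rotate-close r (suc k) _ = refl

    u-moves : ∀ i → u (suc i) ≢ u i
    u-moves i = src-moves (continue (walk i))

    v-moves : ∀ i → v (suc i) ≢ v i
    v-moves i = tgt-moves (continue (walk i))

    cycle-at-repeated-u : ∀ {r t} → r < t → u t ≡ u r → InjectiveBelow t u → InjectiveBelow t v → Cycle (Edge G)
    cycle-at-repeated-u {r} r<t ut≡ur u-inj v-inj with m≤n⇒∃[o]m+o≡n (<⇒≤ r<t)
    ... | k , refl = cycleAt r k (λ i → u (r + i)) (repeat-gap≥2 u u-moves r k r<t ut≡ur)
      (trans ut≡ur (cong u (sym (+-identityʳ r)))) (λ _ → refl)
      (subst (Edge G (u (r + 0)) ∘ v) (+-identityʳ r) (edge-at (r + 0)))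
      (injectiveBelow-shift r u-inj) (injectiveBelow-shift r v-inj)

    cycle-at-repeated-v : ∀ {r t} → r < t → v t ≡ v r →
                          InjectiveBelow (suc t) u → InjectiveBelow t v → Cycle (Edge G)
    cycle-at-repeated-v {r} r<t vt≡vr u-inj v-inj with m≤n⇒∃[o]m+o≡n (<⇒≤ r<t)
    ... | k , refl = cycleAt r k (rotate r k) k≥2 (rotate-close r k (<-≤-trans (s≤s z≤n) k≥2)) (λ _ → refl)
      (subst (Edge G (u (r + k))) vt≡vr (edge-at (r + k)))
      (rotate-injective r k u-inj) (injectiveBelow-shift r v-inj)
      where
      k≥2 : 2 ≤ k
      k≥2 = repeat-gap≥2 v v-moves r k r<t vt≡vr

    visits-bounded : ∀ {t} → InjectiveBelow t u → t ≤ length (left G)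
    visits-bounded {t} inj = subst (_≤ length (left G)) (length-applyDownFrom u t)
      (unique-⊆⇒length≤ _≟X_ (injectiveBelow⇒unique u inj) visited∈left)
      where
      visited∈left : ∀ {x} → x ∈ applyDownFrom u t → x ∈ left G
      visited∈left x∈ with ∈-applyDownFrom⁻ u x∈
      ... | i , _ , refl = proj₁ (edge-ends G (edge-at i))

    open DecMembership _≟X_ using () renaming (_∈?_ to _∈X?_)
    open DecMembership _≟Y_ using () renaming (_∈?_ to _∈Y?_)

    -- Walk on until u t or v t revisits a vertex; as u stays injective, this
    -- happens within length (left G) steps.
    search : ∀ fuel t → fuel + t ≡ suc (length (left G)) → InjectiveBelow t u → InjectiveBelow t v → Cycle (Edge G)
    search zero t refl u-inj _ = ⊥-elim (1+n≰n (visits-bounded u-inj))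
    search (suc fuel) t eq u-inj v-inj with u t ∈X? applyDownFrom u t
    ... | yes ut∈ = let r , r<t , ut≡ur = ∈-applyDownFrom⁻ u ut∈ in cycle-at-repeated-u r<t ut≡ur u-inj v-inj
    ... | no ut∉ with v t ∈Y? applyDownFrom v t
    ...   | yes vt∈ = let r , r<t , vt≡vr = ∈-applyDownFrom⁻ v vt∈ in
                      cycle-at-repeated-v r<t vt≡vr (injectiveBelow-suc u u-inj ut∉) v-inj
    ...   | no vt∉ = search fuel (suc t) (trans (+-suc fuel t) eq)
                       (injectiveBelow-suc u u-inj ut∉) (injectiveBelow-suc v v-inj vt∉)

    cycle : Cycle (Edge G)
    cycle = search (suc (length (left G))) 0 (+-identityʳ _) (λ _ _ ()) (λ _ _ ())

  dense⇒cycle : ∀ n (G : Graph X Y) → order G ≤ n → 0 < order G → order G ≤ size G → Cycle (Edge G)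
  dense⇒cycle zero G o≤0 0<o _ = ⊥-elim (<⇒≱ 0<o o≤0)
  dense⇒cycle (suc n) G o≤1+n 0<o o≤s
    with _ , e₀ ← ∈-of-nonempty (<-≤-trans 0<o o≤s)
    with any? (λ x → degreeˡ G x ≤? 1) (left G) | any? (λ y → degreeʳ G y ≤? 1) (right G)
  ... | yes leafˡ | _ =
    let x , x∈ , deg≤1 = find leafˡ in
    cycle-weaken (λ e∈ → proj₁ (∈-filter⁻ _ e∈))
      (dense⇒cycle n (deleteˡ G x) (≤-pred (subst (_≤ suc n) (sym (order-deleteˡ G x∈)) o≤1+n))
        (<-≤-trans (∈-length (proj₂ (edge-ends G e₀))) (m≤n+m _ _))
        (leaf-deletion-keeps-dense (order-deleteˡ G x∈) (size-deleteˡ G x) deg≤1 o≤s))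
  ... | no _ | yes leafʳ =
    let y , y∈ , deg≤1 = find leafʳ in
    cycle-weaken (λ e∈ → proj₁ (∈-filter⁻ _ e∈))
      (dense⇒cycle n (deleteʳ G y) (≤-pred (subst (_≤ suc n) (sym (order-deleteʳ G y∈)) o≤1+n))
        (<-≤-trans (∈-length (proj₁ (edge-ends G e₀))) (m≤m+n _ _))
        (leaf-deletion-keeps-dense (order-deleteʳ G y∈) (size-deleteʳ G y) deg≤1 o≤s))
  ... | no noLeafˡ | no noLeafʳ =
    Walk.cycle G (λ x∈ → branchingˡ G (≰⇒> (noLeafˡ ∘ lose x∈)))
                 (λ y∈ → branchingʳ G (≰⇒> (noLeafʳ ∘ lose y∈))) e₀

acyclic⇒sparse : {X Y : Set} → DecidableEquality X → DecidableEquality Y →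
                 (G : Graph X Y) → ¬ Cycle (Edge G) → Sparse G
acyclic⇒sparse _≟X_ _≟Y_ G acyclic 0<o with size G <? order G
... | yes s<o = s<o
... | no s≮o = ⊥-elim (acyclic (Dense.dense⇒cycle _≟X_ _≟Y_ (order G) G ≤-refl 0<o (≮⇒≥ s≮o)))

module CycleGraph {X Y : Set} {E : X → Y → Set} (c : Cycle E) where
  open Cycle c

  a-next∈ : ∀ {i} → i < k → a (suc i) ∈ applyDownFrom a k
  a-next∈ {i} i<k with m<1+n⇒m<n∨m≡n (s≤s i<k)
  ... | inj₁ 1+i<k = ∈-applyDownFrom⁺ a 1+i<k
  ... | inj₂ 1+i≡k = subst (_∈ applyDownFrom a k) (trans (sym close) (cong a (sym 1+i≡k)))
                           (∈-applyDownFrom⁺ a (<-≤-trans (s≤s z≤n) k≥2))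

  a-next≢ : ∀ {i} → i < k → a i ≢ a (suc i)
  a-next≢ {i} i<k ai≡a1+i with m<1+n⇒m<n∨m≡n (s≤s i<k)
  ... | inj₁ 1+i<k = 1+n≢n (sym (a-inj i (suc i) i<k 1+i<k ai≡a1+i))
  ... | inj₂ refl with a-inj i 0 i<k (<-≤-trans (s≤s z≤n) k≥2) (trans ai≡a1+i close)
  ...   | refl = <⇒≱ k≥2 ≤-refl

  edges₁ edges₂ : List (X × Y)
  edges₁ = applyDownFrom (λ i → a i , b i) k
  edges₂ = applyDownFrom (λ i → a (suc i) , b i) k

  b-inj-on-edges : ∀ {g : ℕ → X} → InjectiveBelow k (λ i → g i , b i)
  b-inj-on-edges i j i<k j<k eq = b-inj i j i<k j<k (cong proj₂ eq)

  edges-disjoint : ∀ {e} → ¬ (e ∈ edges₁ × e ∈ edges₂)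
  edges-disjoint (e∈₁ , e∈₂) with ∈-applyDownFrom⁻ _ e∈₁ | ∈-applyDownFrom⁻ _ e∈₂
  ... | i , i<k , refl | j , j<k , eq with b-inj i j i<k j<k (cong proj₂ eq)
  ...   | refl = a-next≢ i<k (cong proj₁ eq)

  cycleGraph : Graph X Y
  cycleGraph = record
    { left = applyDownFrom a k
    ; right = applyDownFrom b k
    ; edges = edges₁ ++ edges₂
    ; left-unique = injectiveBelow⇒unique a a-inj
    ; right-unique = injectiveBelow⇒unique b b-inj
    ; edges-unique = Unique.++⁺ (injectiveBelow⇒unique _ b-inj-on-edges) (injectiveBelow⇒unique _ b-inj-on-edges)
                                edges-disjoint
    ; edge-ends = ends
    }
    where
    ends : ∀ {x y} → (x , y) ∈ edges₁ ++ edges₂ → x ∈ applyDownFrom a k × y ∈ applyDownFrom b k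
    ends e∈ with ∈-++⁻ edges₁ e∈
    ... | inj₁ e∈₁ with ∈-applyDownFrom⁻ _ e∈₁
    ...   | i , i<k , refl = ∈-applyDownFrom⁺ a i<k , ∈-applyDownFrom⁺ b i<k
    ends e∈ | inj₂ e∈₂ with ∈-applyDownFrom⁻ _ e∈₂
    ...   | i , i<k , refl = a-next∈ i<k , ∈-applyDownFrom⁺ b i<k

  cycleGraph-edge : ∀ {x y} → Edge cycleGraph x y → E x y
  cycleGraph-edge e∈ with ∈-++⁻ edges₁ e∈
  ... | inj₁ e∈₁ with ∈-applyDownFrom⁻ _ e∈₁
  ...   | i , i<k , refl = edge₁ i i<k
  cycleGraph-edge e∈ | inj₂ e∈₂ with ∈-applyDownFrom⁻ _ e∈₂
  ...   | i , i<k , refl = edge₂ i i<k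

  cycleGraph-not-sparse : ¬ Sparse cycleGraph
  cycleGraph-not-sparse sparse = <-irrefl size≡order (sparse (subst (0 <_) (sym order≡2k) 0<2k))
    where
    order≡2k : order cycleGraph ≡ k + k
    order≡2k = cong₂ _+_ (length-applyDownFrom a k) (length-applyDownFrom b k)
    size≡order : size cycleGraph ≡ order cycleGraph
    size≡order = trans (length-++ edges₁)
      (trans (cong₂ _+_ (length-applyDownFrom _ k) (length-applyDownFrom _ k)) (sym order≡2k))
    0<2k : 0 < k + k
    0<2k = <-≤-trans (s≤s z≤n) (≤-trans k≥2 (m≤m+n k k))

module Words {A : Set} (_≟_ : DecidableEquality A) where

  Word : Set
  Word = List A

  record GeneralisedExtension (S : Lang A) (w : Word) (G : Graph Word Word) : Set where
    field
      left-nonempty  : ∀ {u} → u ∈ left G → u ≢ []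
      right-nonempty : ∀ {v} → v ∈ right G → v ≢ []
      left-suffix    : ∀ {u u′} s → u ∈ left G → u′ ∈ left G → u′ ≡ s ++ u → s ≡ []
      right-prefix   : ∀ {v v′} t → v ∈ right G → v′ ∈ right G → v′ ≡ v ++ t → t ≡ []
      edge-in        : ∀ {u v} → Edge G u v → S (u ++ w ++ v)

  letterCount : List Word → ℕ
  letterCount V = sum (map length V)

  weight : Graph Word Word → ℕ
  weight G = letterCount (left G) + letterCount (right G)

  Short : List Word → Set
  Short V = ∀ {v} → v ∈ V → length v < 2

  BaseCase : Lang A → Set
  BaseCase S = ∀ {w} G → GeneralisedExtension S w G → Short (left G) → Short (right G) → Sparse G

  -- Junk value: the empty word is sent to d.
  headOr : A → Word → A
  headOr d [] = d
  headOr _ (x ∷ _) = x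

  some-letter : ∀ {u : Word} → u ≢ [] → A
  some-letter {[]} u≢[] = ⊥-elim (u≢[] refl)
  some-letter {x ∷ _} _ = x

  short-singleton : ∀ d {u : Word} → u ≢ [] → length u < 2 → u ≡ [ headOr d u ]
  short-singleton d {[]} u≢[] _ = ⊥-elim (u≢[] refl)
  short-singleton d {x ∷ []} _ _ = refl
  short-singleton d {_ ∷ _ ∷ _} _ (s≤s (s≤s ()))

  acyclic⇒baseCase : ∀ {S} → Factorial S → (∀ w → S w → ExtAcyclic S w) → BaseCase S
  acyclic⇒baseCase {S} fS acS {w} G I shortˡ shortʳ = acyclic⇒sparse (≡-dec _≟_) (≡-dec _≟_) G no-cycle
    where
    open GeneralisedExtension I
    no-cycle : ¬ Cycle (Edge G)
    no-cycle c = acS w (fS [ _ ] w [ _ ] (Cycle.edge₁ c′ 0 0<k)) (cycle⇒extCycle c′)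
      where
      0<k : 0 < Cycle.k c
      0<k = <-≤-trans (s≤s z≤n) (Cycle.k≥2 c)
      d : A
      d = some-letter (left-nonempty (proj₁ (edge-ends G (Cycle.edge₁ c 0 0<k))))
      singleˡ : ∀ {u} → u ∈ left G → u ≡ [ headOr d u ]
      singleˡ u∈ = short-singleton d (left-nonempty u∈) (shortˡ u∈)
      singleʳ : ∀ {v} → v ∈ right G → v ≡ [ headOr d v ]
      singleʳ v∈ = short-singleton d (right-nonempty v∈) (shortʳ v∈)
      c′ : Cycle (E S w)
      c′ = mapCycle (headOr d) (headOr d)
        (λ {u} {v} e → let u∈ , v∈ = edge-ends G e in
           subst S (cong₂ (λ u′ v′ → u′ ++ w ++ v′) (singleˡ u∈) (singleʳ v∈)) (edge-in e))
        (λ e e′ h≡h → trans (singleˡ (proj₁ (edge-ends G e)))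
                             (trans (cong [_] h≡h) (sym (singleˡ (proj₁ (edge-ends G e′))))))
        (λ e e′ h≡h → trans (singleʳ (proj₂ (edge-ends G e)))
                             (trans (cong [_] h≡h) (sym (singleʳ (proj₂ (edge-ends G e′))))))
        c

  Reversed : Lang A → Lang A
  Reversed S x = S (reverse x)

  reverse-++₃ : ∀ (u w v : Word) → reverse (u ++ w ++ v) ≡ reverse v ++ reverse w ++ reverse u
  reverse-++₃ u w v = begin
    reverse (u ++ w ++ v)                   ≡⟨ reverse-++ u (w ++ v) ⟩
    reverse (w ++ v) ++ reverse u           ≡⟨ cong (_++ reverse u) (reverse-++ w v) ⟩
    (reverse v ++ reverse w) ++ reverse u   ≡⟨ ++-assoc (reverse v) (reverse w) (reverse u) ⟩
    reverse v ++ reverse w ++ reverse u     ∎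
    where open ≡-Reasoning

  reversed-factorial : ∀ {S} → Factorial S → Factorial (Reversed S)
  reversed-factorial {S} fS u w v s = fS (reverse v) (reverse w) (reverse u) (subst S (reverse-++₃ u w v) s)

  flipReverse : Word × Word → Word × Word
  flipReverse (u , v) = reverse v , reverse u

  flipReverse-involutive : ∀ e → flipReverse (flipReverse e) ≡ e
  flipReverse-involutive (u , v) = cong₂ _,_ (reverse-involutive u) (reverse-involutive v)

  ∈-map-reverse⁻ : ∀ {x : Word} {V} → x ∈ map reverse V → reverse x ∈ V
  ∈-map-reverse⁻ {V = V} = ∈-map-retract⁻ {f = reverse} {reverse} {V} (λ {v} _ → reverse-involutive v)

  ∈-map-flipReverse⁻ : ∀ {e Ed} → e ∈ map flipReverse Ed → flipReverse e ∈ Ed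
  ∈-map-flipReverse⁻ {Ed = Ed} =
    ∈-map-retract⁻ {f = flipReverse} {flipReverse} {Ed} (λ {e} _ → flipReverse-involutive e)

  reverseGraph : Graph Word Word → Graph Word Word
  reverseGraph G = record
    { left = map reverse (right G)
    ; right = map reverse (left G)
    ; edges = map flipReverse (edges G)
    ; left-unique = Unique.map⁺ reverse-injective (right-unique G)
    ; right-unique = Unique.map⁺ reverse-injective (left-unique G)
    ; edges-unique = Unique.map⁺ (λ {e} {e′} eq → trans (sym (flipReverse-involutive e))
                                   (trans (cong flipReverse eq) (flipReverse-involutive e′))) (edges-unique G)
    ; edge-ends = λ {u} {v} e∈ → let v′∈ , u′∈ = edge-ends G (∈-map-flipReverse⁻ e∈) in
                   subst (_∈ _) (reverse-involutive u) (∈-map⁺ reverse u′∈) ,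
                   subst (_∈ _) (reverse-involutive v) (∈-map⁺ reverse v′∈)
    }

  letterCount-reverse : ∀ V → letterCount (map reverse V) ≡ letterCount V
  letterCount-reverse [] = refl
  letterCount-reverse (v ∷ V) = cong₂ _+_ (length-reverse v) (letterCount-reverse V)

  weight-reverse : ∀ G → weight (reverseGraph G) ≡ weight G
  weight-reverse G = trans (cong₂ _+_ (letterCount-reverse (right G)) (letterCount-reverse (left G)))
                           (+-comm (letterCount (right G)) _)

  order-reverse : ∀ G → order (reverseGraph G) ≡ order G
  order-reverse G = trans (cong₂ _+_ (length-map reverse (right G)) (length-map reverse (left G)))
                          (+-comm (length (right G)) _)

  sparse-reverse : ∀ G → Sparse (reverseGraph G) → Sparse G
  sparse-reverse G sparse 0<o = subst₂ _<_ (length-map flipReverse (edges G)) (order-reverse G)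
                                       (sparse (subst (0 <_) (sym (order-reverse G)) 0<o))

  reverse-extension : ∀ {S T : Lang A} {w G} → (∀ x → S x → T (reverse x)) →
                      GeneralisedExtension S w G → GeneralisedExtension T (reverse w) (reverseGraph G)
  reverse-extension {S} {T} {w} {G} S⇒T I = record
    { left-nonempty = λ u∈ u≡[] → right-nonempty (∈-map-reverse⁻ u∈) (cong reverse u≡[])
    ; right-nonempty = λ v∈ v≡[] → left-nonempty (∈-map-reverse⁻ v∈) (cong reverse v≡[])
    ; left-suffix = λ s u∈ u′∈ u′≡su → reverse-injective (right-prefix (reverse s)
        (∈-map-reverse⁻ u∈) (∈-map-reverse⁻ u′∈)
        (trans (cong reverse u′≡su) (reverse-++ s _)))
    ; right-prefix = λ {v} t v∈ v′∈ v′≡vt → reverse-injective (left-suffix (reverse t)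
        (∈-map-reverse⁻ v∈) (∈-map-reverse⁻ v′∈)
        (trans (cong reverse v′≡vt) (reverse-++ v t)))
    ; edge-in = λ {u} {v} e∈ → subst T (reverse-edge u v)
        (S⇒T _ (edge-in (∈-map-flipReverse⁻ e∈)))
    }
    where
    open GeneralisedExtension I
    reverse-edge : ∀ u v → reverse (reverse v ++ w ++ reverse u) ≡ u ++ reverse w ++ v
    reverse-edge u v = trans (reverse-++₃ (reverse v) w (reverse u))
      (cong₂ (λ u′ v′ → u′ ++ reverse w ++ v′) (reverse-involutive u) (reverse-involutive v))

  reversed-baseCase : ∀ {S} → BaseCase S → BaseCase (Reversed S)
  reversed-baseCase base G I shortˡ shortʳ = sparse-reverse G
    (base (reverseGraph G) (reverse-extension (λ _ s → s) I) (short-reverse shortʳ) (short-reverse shortˡ))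
    where
    short-reverse : ∀ {V} → Short V → Short (map reverse V)
    short-reverse short {v} v∈ = subst (_< 2) (length-reverse v) (short (∈-map-reverse⁻ v∈))

  StartsWith : A → Word → Set
  StartsWith d v = ∃[ t ] v ≡ d ∷ t

  startsWith? : ∀ d → Decidable (StartsWith d)
  startsWith? d [] = no λ ()
  startsWith? d (x ∷ t) with x ≟ d
  ... | yes refl = yes (t , refl)
  ... | no x≢d = no λ (_ , eq) → x≢d (∷-injectiveˡ eq)

  cons-drop : ∀ {d v} → StartsWith d v → d ∷ drop 1 v ≡ v
  cons-drop (_ , refl) = refl

  singleton-prefix : ∀ {d v t} → v ≢ [] → [ d ] ≡ v ++ t → StartsWith d v
  singleton-prefix {v = []} v≢[] _ = ⊥-elim (v≢[] refl)
  singleton-prefix {v = x ∷ v} _ eq = v , cong (_∷ v) (sym (∷-injectiveˡ eq))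

  letterCount-cons : ∀ d Q → letterCount (map (d ∷_) Q) ≡ length Q + letterCount Q
  letterCount-cons d [] = refl
  letterCount-cons d (t ∷ Q) =
    cong suc (trans (cong (length t +_) (letterCount-cons d Q)) (x∙yz≈y∙xz (length t) (length Q) _))

  split-count : ∀ {eo n em u vo m} → eo + n < u + suc vo → em < n + m → em + eo < u + (m + vo)
  split-count {eo} {n} {em} {u} {vo} {m} h₁ h₂ = +-cancelʳ-≤ n _ _ (begin
    suc (em + eo) + n     ≡⟨ lhs em eo n ⟩
    (eo + n) + suc em     ≤⟨ +-mono-≤ (≤-pred (subst (suc (eo + n) ≤_) (+-suc u vo) h₁)) h₂ ⟩
    (u + vo) + (n + m)    ≡⟨ rhs u vo n m ⟩
    u + (m + vo) + n      ∎)
    where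
    open ≤-Reasoning
    lhs : ∀ em eo n → suc (em + eo) + n ≡ (eo + n) + suc em
    lhs = solve-∀
    rhs : ∀ u vo n m → (u + vo) + (n + m) ≡ u + (m + vo) + n
    rhs = solve-∀

  prefix-closed : ∀ {S : Lang A} → Factorial S → ∀ x y → S (x ++ y) → S x
  prefix-closed fS x y = fS [] x y

  -- G₁ merges the right vertices starting with d into [ d ]; G₂ is the merged
  -- part, with d moved into the context.
  module Split {S : Lang A} (fS : Factorial S) {w : Word} (G : Graph Word Word)
               (I : GeneralisedExtension S w G) {d e : A} {q : Word} (long : d ∷ e ∷ q ∈ right G) where
    open GeneralisedExtension I
    open DecMembership (≡-dec _≟_) using (_∈?_)

    M Vo : List Word
    M = filter (startsWith? d) (right G)
    Vo = filter (∁? (startsWith? d)) (right G)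

    Q : List Word
    Q = map (drop 1) M

    EdM Edo : List (Word × Word)
    EdM = filter (startsWith? d ∘ proj₂) (edges G)
    Edo = filter (∁? (startsWith? d ∘ proj₂)) (edges G)

    EdQ : List (Word × Word)
    EdQ = map (map₂ (drop 1)) EdM

    N : List Word
    N = filter (_∈? map proj₁ EdM) (left G)

    M⁻ : ∀ {v} → v ∈ M → v ∈ right G × StartsWith d v
    M⁻ = ∈-filter⁻ (startsWith? d) {xs = right G}

    Vo⁻ : ∀ {v} → v ∈ Vo → v ∈ right G × ¬ StartsWith d v
    Vo⁻ = ∈-filter⁻ (∁? (startsWith? d)) {xs = right G}

    EdM⁻ : ∀ {e} → e ∈ EdM → e ∈ edges G × StartsWith d (proj₂ e)
    EdM⁻ = ∈-filter⁻ (startsWith? d ∘ proj₂) {xs = edges G}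

    Edo⁻ : ∀ {e} → e ∈ Edo → e ∈ edges G × ¬ StartsWith d (proj₂ e)
    Edo⁻ = ∈-filter⁻ (∁? (startsWith? d ∘ proj₂)) {xs = edges G}

    N⁻ : ∀ {u} → u ∈ N → u ∈ left G × u ∈ map proj₁ EdM
    N⁻ = ∈-filter⁻ (_∈? map proj₁ EdM) {xs = left G}

    M-restore : ∀ {v} → v ∈ M → d ∷ drop 1 v ≡ v
    M-restore v∈ = cons-drop (proj₂ (M⁻ v∈))

    EdM-restore : ∀ {e} → e ∈ EdM → map₂ (d ∷_) (map₂ (drop 1) e) ≡ e
    EdM-restore {u , v} e∈ = cong (u ,_) (cons-drop (proj₂ (EdM⁻ e∈)))

    Q⁻ : ∀ {t} → t ∈ Q → d ∷ t ∈ right G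
    Q⁻ t∈ = proj₁ (M⁻ (∈-map-retract⁻ M-restore t∈))

    EdQ⁻ : ∀ {u t} → (u , t) ∈ EdQ → (u , d ∷ t) ∈ EdM
    EdQ⁻ e∈ = ∈-map-retract⁻ EdM-restore e∈

    continue-edge : ∀ {u t} → Edge G u (d ∷ t) → S (u ++ (w ++ [ d ]) ++ t)
    continue-edge {u} {t} e∈ = subst S (cong (u ++_) (sym (++-assoc w [ d ] t))) (edge-in e∈)

    merged-edge : ∀ {u} → u ∈ N → S (u ++ w ++ [ d ])
    merged-edge {u} u∈ with ∈-map⁻ proj₁ (proj₂ (N⁻ u∈))
    ... | (_ , v) , e∈ , refl with EdM⁻ e∈
    ...   | e∈G , t , refl = prefix-closed fS (u ++ w ++ [ d ]) t (subst S (sym reassociate) (edge-in e∈G))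
      where
      reassociate : (u ++ w ++ [ d ]) ++ t ≡ u ++ w ++ d ∷ t
      reassociate = trans (++-assoc u (w ++ [ d ]) t) (cong (u ++_) (++-assoc w [ d ] t))

    G₁ : Graph Word Word
    G₁ = record
      { left = left G
      ; right = [ d ] ∷ Vo
      ; edges = Edo ++ map (_, [ d ]) N
      ; left-unique = left-unique G
      ; right-unique = All.tabulate (λ v∈ [d]≡v → proj₂ (Vo⁻ v∈) (subst (StartsWith d) [d]≡v ([] , refl)))
                       ∷ Unique.filter⁺ _ (right-unique G)
      ; edges-unique = Unique.++⁺ (Unique.filter⁺ _ (edges-unique G))
                         (Unique.map⁺ (cong proj₁) (Unique.filter⁺ _ (left-unique G))) disjoint
      ; edge-ends = ends
      }
      where
      disjoint : ∀ {e} → ¬ (e ∈ Edo × e ∈ map (_, [ d ]) N)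
      disjoint (e∈o , e∈N) with ∈-map⁻ (_, [ d ]) e∈N
      ... | _ , _ , refl = proj₂ (Edo⁻ e∈o) ([] , refl)
      ends : ∀ {u v} → (u , v) ∈ Edo ++ map (_, [ d ]) N → u ∈ left G × v ∈ [ d ] ∷ Vo
      ends e∈ with ∈-++⁻ Edo e∈
      ... | inj₁ e∈o = let e∈G , ¬d = Edo⁻ e∈o ; u∈ , v∈ = edge-ends G e∈G in
                       u∈ , there (∈-filter⁺ _ v∈ ¬d)
      ... | inj₂ e∈N with ∈-map⁻ (_, [ d ]) e∈N
      ...   | _ , u∈ , refl = proj₁ (N⁻ u∈) , here refl

    G₁-prefix : ∀ {v v′} t → v ∈ right G₁ → v′ ∈ right G₁ → v′ ≡ v ++ t → t ≡ []
    G₁-prefix t (here refl) (here refl) eq = sym (∷-injectiveʳ eq)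
    G₁-prefix t (here refl) (there v′∈) eq = ⊥-elim (proj₂ (Vo⁻ v′∈) (t , eq))
    G₁-prefix t (there v∈) (here refl) eq =
      ⊥-elim (proj₂ (Vo⁻ v∈) (singleton-prefix (right-nonempty (proj₁ (Vo⁻ v∈))) eq))
    G₁-prefix t (there v∈) (there v′∈) eq = right-prefix t (proj₁ (Vo⁻ v∈)) (proj₁ (Vo⁻ v′∈)) eq

    I₁ : GeneralisedExtension S w G₁
    I₁ = record
      { left-nonempty = left-nonempty
      ; right-nonempty = λ { (here refl) () ; (there v∈) → right-nonempty (proj₁ (Vo⁻ v∈)) }
      ; left-suffix = left-suffix
      ; right-prefix = G₁-prefix
      ; edge-in = edge₁-in
      }
      where
      edge₁-in : ∀ {u v} → Edge G₁ u v → S (u ++ w ++ v)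
      edge₁-in e∈ with ∈-++⁻ Edo e∈
      ... | inj₁ e∈o = edge-in (proj₁ (Edo⁻ e∈o))
      ... | inj₂ e∈N with ∈-map⁻ (_, [ d ]) e∈N
      ...   | _ , u∈ , refl = merged-edge u∈

    G₂ : Graph Word Word
    G₂ = record
      { left = N
      ; right = Q
      ; edges = EdQ
      ; left-unique = Unique.filter⁺ _ (left-unique G)
      ; right-unique = unique-map-retract {f = d ∷_} M-restore (Unique.filter⁺ _ (right-unique G))
      ; edges-unique = unique-map-retract {f = map₂ (d ∷_)} EdM-restore (Unique.filter⁺ _ (edges-unique G))
      ; edge-ends = ends
      }
      where
      ends : ∀ {u t} → (u , t) ∈ EdQ → u ∈ N × t ∈ Q
      ends {u} {t} e∈ = let e∈M = EdQ⁻ e∈ ; e∈G , d∷t = EdM⁻ e∈M in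
        ∈-filter⁺ _ (proj₁ (edge-ends G e∈G)) (∈-map⁺ proj₁ e∈M) ,
        ∈-map⁺ (drop 1) (∈-filter⁺ (startsWith? d) (proj₂ (edge-ends G e∈G)) d∷t)

    I₂ : GeneralisedExtension S (w ++ [ d ]) G₂
    I₂ = record
      { left-nonempty = left-nonempty ∘ proj₁ ∘ N⁻
      ; right-nonempty = λ t∈ t≡[] →
          case right-prefix (e ∷ q) (subst (λ t → d ∷ t ∈ right G) t≡[] (Q⁻ t∈)) long refl of λ ()
      ; left-suffix = λ s u∈ u′∈ → left-suffix s (proj₁ (N⁻ u∈)) (proj₁ (N⁻ u′∈))
      ; right-prefix = λ s t∈ t′∈ eq → right-prefix s (Q⁻ t∈) (Q⁻ t′∈) (cong (d ∷_) eq)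
      ; edge-in = λ e∈ → continue-edge (proj₁ (EdM⁻ (EdQ⁻ e∈)))
      }

    long∈M : d ∷ e ∷ q ∈ M
    long∈M = ∈-filter⁺ (startsWith? d) long (e ∷ q , refl)

    0<|Q| : 0 < length Q
    0<|Q| = ∈-length (∈-map⁺ (drop 1) long∈M)

    letterCount-Q<M : letterCount Q < letterCount M
    letterCount-Q<M = subst (letterCount Q <_)
      (trans (sym (letterCount-cons d Q)) (cong letterCount (map-retract M-restore)))
      (m<n+m (letterCount Q) 0<|Q|)

    letterCount-V : letterCount M + letterCount Vo ≡ letterCount (right G)
    letterCount-V = sum-filter-partition (startsWith? d) length (right G)

    weight₁< : weight G₁ < weight G
    weight₁< = +-monoʳ-< (letterCount (left G)) (subst (suc (suc (letterCount Vo)) ≤_) letterCount-V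
      (+-monoˡ-≤ (letterCount Vo) (≤-trans (s≤s (s≤s z≤n)) (∈⇒≤sum length long∈M))))

    weight₂< : weight G₂ < weight G
    weight₂< = begin-strict
      letterCount N + letterCount Q                            <⟨ +-monoʳ-< (letterCount N) letterCount-Q<M ⟩
      letterCount N + letterCount M                            ≤⟨ +-mono-≤ (sum-filter≤ (_∈? map proj₁ EdM) length (left G))
                                                                           (m≤m+n (letterCount M) (letterCount Vo)) ⟩
      letterCount (left G) + (letterCount M + letterCount Vo)  ≡⟨ cong (letterCount (left G) +_) letterCount-V ⟩
      weight G                                                 ∎
      where open ≤-Reasoning

    sparse : (∀ {w′} G′ → GeneralisedExtension S w′ G′ → weight G′ < weight G → Sparse G′) → Sparse G
    sparse sparse< _ = subst₂ _<_
      (length-filter-partition (startsWith? d ∘ proj₂) (edges G))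
      (cong (length (left G) +_) (length-filter-partition (startsWith? d) (right G)))
      (split-count
        (subst (_< order G₁) (trans (length-++ Edo) (cong (length Edo +_) (length-map (_, [ d ]) N)))
               (sparse< G₁ I₁ weight₁< (<-≤-trans z<s (m≤n+m _ (length (left G))))))
        (subst₂ _<_ (length-map (map₂ (drop 1)) EdM) (cong (length N +_) (length-map (drop 1) M))
               (sparse< G₂ I₂ weight₂< (<-≤-trans 0<|Q| (m≤n+m _ (length N))))))

  bifixCode-extension : ∀ {S X : Lang A} {w} → BifixCode X → (G : Graph Word Word) →
                        (∀ {u} → u ∈ left G → X u) → (∀ {v} → v ∈ right G → X v) →
                        (∀ {u v} → Edge G u v → S (u ++ w ++ v)) → GeneralisedExtension S w G
  bifixCode-extension (nonempty , prefix , suffix) G ˡ∈X ʳ∈X edge-in = record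
    { left-nonempty = λ u∈ → nonempty _ (ˡ∈X u∈)
    ; right-nonempty = λ v∈ → nonempty _ (ʳ∈X v∈)
    ; left-suffix = λ s u∈ u′∈ → suffix _ _ s (ˡ∈X u′∈) (ˡ∈X u∈)
    ; right-prefix = λ t v∈ v′∈ → prefix _ _ t (ʳ∈X v′∈) (ʳ∈X v∈)
    ; edge-in = edge-in
    }

  long-word : ∀ {v : Word} {V} → v ∈ V → 2 ≤ length v → ∃[ d ] ∃[ e ] ∃[ q ] d ∷ e ∷ q ∈ V
  long-word {_ ∷ []} _ (s≤s ())
  long-word {d ∷ e ∷ q} v∈ _ = d , e , q , v∈

  sparse-below : ∀ n {S} → Factorial S → BaseCase S →
                 ∀ {w} G → GeneralisedExtension S w G → weight G < n → Sparse G
  sparse-below (suc n) {S} fS base G I w<1+n with any? (λ v → 2 ≤? length v) (right G)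
  ... | yes longʳ =
    let v , v∈ , 2≤|v| = find longʳ ; _ , _ , _ , long = long-word v∈ 2≤|v| in
    Split.sparse fS G I long (λ G′ I′ w′< → sparse-below n fS base G′ I′ (<-≤-trans w′< (≤-pred w<1+n)))
  ... | no shortʳ with any? (λ u → 2 ≤? length u) (left G)
  ...   | yes longˡ =
    let u , u∈ , 2≤|u| = find longˡ
        _ , _ , _ , long = long-word (∈-map⁺ reverse u∈) (subst (2 ≤_) (sym (length-reverse u)) 2≤|u|)
    in sparse-reverse G (Split.sparse (reversed-factorial fS) (reverseGraph G)
         (reverse-extension (λ x s → subst S (sym (reverse-involutive x)) s) I) long
         (λ G′ I′ w′< → sparse-below n (reversed-factorial fS) (reversed-baseCase base) G′ I′
                          (<-≤-trans (subst (weight G′ <_) (weight-reverse G) w′<) (≤-pred w<1+n))))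
  ...   | no shortˡ = base G I (λ u∈ → ≰⇒> (shortˡ ∘ lose u∈)) (λ v∈ → ≰⇒> (shortʳ ∘ lose v∈))

  generalisedExtension-sparse : ∀ {S} → Factorial S → (∀ w → S w → ExtAcyclic S w) →
                                ∀ {w} G → GeneralisedExtension S w G → Sparse G
  generalisedExtension-sparse fS acS G I = sparse-below (suc (weight G)) fS (acyclic⇒baseCase fS acS) G I ≤-refl

decoding-edge : {A B : Set} {S : Lang A} (f : B → List A) {w : List B} {α β : B} →
                E (decoding f S) w α β → S (f α ++ morph f w ++ f β)
decoding-edge {S = S} f {w} {α} {β} =
  subst S (cong (f α ++_) (trans (concatMap-++ f w [ β ]) (cong (morph f w ++_) (++-identityʳ (f β)))))

theorem3p11 : (n : ℕ) (S : Lang (Fin (suc n))) → Acyclic S →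
    (X : Lang (Fin (suc n))) → (∀ x → X x → S x) → BifixCode X →
    (m : ℕ) (f : Fin m → List (Fin (suc n))) → CodingMorphism X f →
    Biextendable (decoding f S) → Acyclic (decoding f S)
theorem3p11 n S ((fS , _) , acS) X _ code m f (f-inj , image) biext = biext , λ w _ → no-cycle w
  where
  open Words Fin._≟_

  f∈X : ∀ β → X (f β)
  f∈X β = Equivalence.from (image (f β)) (β , refl)

  no-cycle : ∀ w → ExtAcyclic (decoding f S) w
  no-cycle w c = cycleGraph-not-sparse (generalisedExtension-sparse fS acS cycleGraph
      (bifixCode-extension code cycleGraph
        (∈-applyDownFrom-all (f∈X ∘ a)) (∈-applyDownFrom-all (f∈X ∘ b)) cycleGraph-edge))
    where
    open ExtCycle c using (a; b)
    open CycleGraph (mapCycle {E′ = λ u v → S (u ++ morph f w ++ v)} f f (decoding-edge {S = S} f {w})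
                              (λ _ _ → f-inj _ _) (λ _ _ → f-inj _ _) (extCycle⇒cycle c))
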